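{- Let $C$ be a binary Hadamard code of length $4n$ and let $s\in K(C)$ with $s\notin\{\mathbf 0,\mathbf 1\}$. Then the projection of $C$ onto the coordinates in $\mathrm{Supp}(s)$ is a binary Hadamard code of length $2n$.
   Context: Let $\mathbb{F}=\mathbb{Z}_2$; $\mathbf 0,\mathbf 1$ denote the all-zero and all-one vectors, and $\mathrm{Supp}(v)$ is the set of nonzero coordinates of $v$. A binary Hadamard matrix of order $N$ is obtained from an $N\times N$ matrix with entries $\pm1$ and $HH^T=NI$ by replacing $+1$ by $0$ and $-1$ by $1$; the binary Hadamard code of length $N$ it defines is the set of its rows together with their complements. The kernel of a code $C\subseteq\mathbb{F}^m$ is $K(C)=\{z\in\mathbb{F}^m: C+z=C\}$. -}

module Defs where

open import Data.Nat using (ℕ; zero; suc)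
open import Data.Bool using (Bool; true; false; not; _xor_)
open import Data.Fin using (Fin; _≟_)
open import Relation.Nullary using (yes; no)
open import Data.Vec using (Vec; []; _∷_; tabulate; map; zipWith)
open import Data.Integer using (ℤ; +_; -_; _+_; _*_)
open import Data.Product using (Σ; ∃; _×_)
open import Data.Sum using (_⊎_)
open import Relation.Binary.PropositionalEquality using (_≡_)
open import Function.Bundles using (_⇔_)

Word : ℕ → Set
Word m = Vec Bool m

Code : ℕ → Set₁
Code m = Word m → Set

𝟎 : ∀ {m} → Word m
𝟎 {m} = tabulate (λ _ → false)

𝟏 : ∀ {m} → Word m
𝟏 {m} = tabulate (λ _ → true)

_⊕_ : ∀ {m} → Word m → Word m → Word m
_⊕_ = zipWith _xor_

complement : ∀ {m} → Word m → Word m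
complement = map not

∑ : (N : ℕ) → (Fin N → ℤ) → ℤ
∑ zero f = + 0
∑ (suc N) f = f Data.Fin.zero + ∑ N (λ i → f (Data.Fin.suc i))

δN : ∀ {N} → Fin N → Fin N → ℤ
δN {N} i j with i ≟ j
... | yes _ = + N
... | no _ = + 0

record IsHadamardMatrix (N : ℕ) (H : Fin N → Fin N → ℤ) : Set where
  field
    entries : ∀ i j → (H i j ≡ + 1) ⊎ (H i j ≡ - (+ 1))
    orthogonal : ∀ i j → ∑ N (λ k → H i k * H j k) ≡ δN i j

toBit : ℤ → Bool
toBit (+ _) = false
toBit (ℤ.negsuc _) = true

binRow : ∀ {N} → (Fin N → Fin N → ℤ) → Fin N → Word N
binRow H i = tabulate (λ j → toBit (H i j))

IsBinaryHadamardCode : (N : ℕ) → Code N → Set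
IsBinaryHadamardCode N C =
  Σ (Fin N → Fin N → ℤ) λ H → IsHadamardMatrix N H ×
    (∀ (v : Word N) → C v ⇔ (∃ λ i → (v ≡ binRow H i) ⊎ (v ≡ complement (binRow H i))))

InKernel : ∀ {m} → Code m → Word m → Set
InKernel {m} C z = ∀ (v : Word m) → C v ⇔ C (v ⊕ z)

wt : ∀ {m} → Word m → ℕ
wt [] = 0
wt (false ∷ s) = wt s
wt (true ∷ s) = suc (wt s)

proj : ∀ {m} (s : Word m) → Word m → Word (wt s)
proj [] [] = []
proj (false ∷ s) (x ∷ v) = proj s v
proj (true ∷ s) (x ∷ v) = x ∷ proj s v

projCode : ∀ {m} → Code m → (s : Word m) → Code (wt s)
projCode C s w = ∃ λ v → C v × proj s v ≡ w

module Submission where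

-- Normalise the rows w_i of the Hadamard matrix to vanish at a coordinate t outside Supp(s).
-- As s lies in the kernel, w_i + s is a codeword vanishing at t, hence a row w_σ(i); σ is injective
-- and, for a fixed j in Supp(s), exchanges the rows with w_i[j] = 0 and those with w_i[j] = 1,
-- so both classes have the same size. Split the ±1 inner product as A + B with A taken over
-- Supp(s); adding s to one argument turns it into -A + B. For i ≠ k and i ≠ σ(k) both vanish,
-- so the projections of w_i and w_k onto Supp(s) are orthogonal, and for k = σ(i) we get
-- |Supp(s)| = 4n - |Supp(s)|. Hence the 2n rows with w_i[j] = 0, projected onto Supp(s), form
-- a Hadamard matrix, and σ shows every other projected row is the complement of one of them.

open import Defs
open import Data.Nat using (ℕ; zero; suc; _+_; _*_; _≤_)
import Data.Nat.Properties as ℕ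
open import Data.Bool using (Bool; true; false; not; _xor_)
import Data.Bool.Properties as Bool
open import Data.Fin using (Fin; _≟_)
import Data.Fin as Fin
open import Data.Fin.Properties using (injective⇒≤)
open import Data.Vec using ([]; _∷_; tabulate; lookup)
import Data.Vec.Properties as Vec
open import Data.List using (List; length; filter; allFin)
import Data.List as List
import Data.List.Properties as List
open import Data.List.Relation.Unary.Unique.Propositional using (Unique)
import Data.List.Relation.Unary.Unique.Propositional.Properties as Unique
open import Data.List.Relation.Unary.AllPairs using (_∷_)
import Data.List.Relation.Unary.All as All
import Data.List.Relation.Unary.Any as Any
import Data.List.Relation.Unary.Any.Properties as Any
open import Data.List.Membership.Propositional.Properties using (∈-lookup; ∈-filter⁺; ∈-filter⁻; ∈-allFin)
open import Data.Integer using (ℤ; +_; -_; 0ℤ; 1ℤ; -1ℤ) renaming (_+_ to _+ℤ_; _*_ to _*ℤ_)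
import Data.Integer.Properties as ℤ
open import Algebra.Properties.AbelianGroup ℤ.+-0-abelianGroup using (∙-cancelʳ)
open import Algebra.Properties.CommutativeSemigroup ℤ.+-commutativeSemigroup using (x∙yz≈y∙xz)
open import Data.Product using (∃; ∃₂; _×_; _,_; proj₁; proj₂)
open import Data.Sum using (_⊎_; inj₁; inj₂)
open import Data.Empty using (⊥-elim)
open import Function using (_∘_)
open import Function.Bundles using (_⇔_; mk⇔; Equivalence)
open import Function.Definitions using (Injective)
import Function.Properties.Equivalence as ⇔
open import Relation.Binary.PropositionalEquality
open import Relation.Nullary using (¬_; yes; no; Dec)
open import Relation.Unary using (Decidable)
open import Relation.Unary.Properties using (∁?)

open Equivalence using (to; from)

private
  variable
    m N : ℕ

complement-involutive : (x : Word m) → complement (complement x) ≡ x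
complement-involutive [] = refl
complement-involutive (a ∷ x) = cong₂ _∷_ (Bool.not-involutive a) (complement-involutive x)

xor-cancelʳ : ∀ a b → (a xor b) xor b ≡ a
xor-cancelʳ a b = begin
  (a xor b) xor b ≡⟨ Bool.xor-assoc a b b ⟩
  a xor (b xor b) ≡⟨ cong (a xor_) (Bool.xor-same b) ⟩
  a xor false     ≡⟨ Bool.xor-identityʳ a ⟩
  a               ∎
  where open ≡-Reasoning

⊕-cancelʳ : (x s : Word m) → (x ⊕ s) ⊕ s ≡ x
⊕-cancelʳ [] [] = refl
⊕-cancelʳ (a ∷ x) (b ∷ s) = cong₂ _∷_ (xor-cancelʳ a b) (⊕-cancelʳ x s)

lookup-⊕ : (x y : Word m) (k : Fin m) → lookup (x ⊕ y) k ≡ lookup x k xor lookup y k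
lookup-⊕ x y k = Vec.lookup-zipWith _xor_ k x y

≢𝟎⇒∃true : (s : Word m) → ¬ s ≡ 𝟎 → ∃ λ j → lookup s j ≡ true
≢𝟎⇒∃true [] s≢𝟎 = ⊥-elim (s≢𝟎 refl)
≢𝟎⇒∃true (true ∷ s) _ = Fin.zero , refl
≢𝟎⇒∃true (false ∷ s) s≢𝟎 with ≢𝟎⇒∃true s (s≢𝟎 ∘ cong (false ∷_))
... | j , s[j]≡1 = Fin.suc j , s[j]≡1

≢𝟏⇒∃false : (s : Word m) → ¬ s ≡ 𝟏 → ∃ λ t → lookup s t ≡ false
≢𝟏⇒∃false [] s≢𝟏 = ⊥-elim (s≢𝟏 refl)
≢𝟏⇒∃false (false ∷ s) _ = Fin.zero , refl
≢𝟏⇒∃false (true ∷ s) s≢𝟏 with ≢𝟏⇒∃false s (s≢𝟏 ∘ cong (true ∷_))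
... | t , s[t]≡0 = Fin.suc t , s[t]≡0

wt+wt-complement : (s : Word m) → wt s + wt (complement s) ≡ m
wt+wt-complement [] = refl
wt+wt-complement (false ∷ s) = trans (ℕ.+-suc (wt s) _) (cong suc (wt+wt-complement s))
wt+wt-complement (true ∷ s) = cong suc (wt+wt-complement s)

proj-complement : (s x : Word m) → proj s (complement x) ≡ complement (proj s x)
proj-complement [] [] = refl
proj-complement (false ∷ s) (a ∷ x) = proj-complement s x
proj-complement (true ∷ s) (a ∷ x) = cong (not a ∷_) (proj-complement s x)

proj-⊕-self : (s x : Word m) → proj s (x ⊕ s) ≡ complement (proj s x)
proj-⊕-self [] [] = refl
proj-⊕-self (false ∷ s) (a ∷ x) = proj-⊕-self s x
proj-⊕-self (true ∷ s) (a ∷ x) = cong₂ _∷_ (Bool.xor-comm a true) (proj-⊕-self s x)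

proj-complement-⊕-self : (s x : Word m) → proj (complement s) (x ⊕ s) ≡ proj (complement s) x
proj-complement-⊕-self [] [] = refl
proj-complement-⊕-self (false ∷ s) (a ∷ x) = cong₂ _∷_ (Bool.xor-identityʳ a) (proj-complement-⊕-self s x)
proj-complement-⊕-self (true ∷ s) (a ∷ x) = proj-complement-⊕-self s x

sign : Bool → ℤ
sign false = 1ℤ
sign true = -1ℤ

sign-* : ∀ a b → sign a *ℤ sign b ≡ sign (a xor b)
sign-* false b = ℤ.*-identityˡ (sign b)
sign-* true false = refl
sign-* true true = refl

sign-not : ∀ a → sign (not a) ≡ - sign a
sign-not false = refl
sign-not true = refl

sign-toBit : ∀ z → (z ≡ + 1) ⊎ (z ≡ - (+ 1)) → sign (toBit z) ≡ z
sign-toBit _ (inj₁ refl) = refl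
sign-toBit _ (inj₂ refl) = refl

toBit-sign : ∀ a → toBit (sign a) ≡ a
toBit-sign false = refl
toBit-sign true = refl

⟪_,_⟫ : Word m → Word m → ℤ
⟪ [] , [] ⟫ = 0ℤ
⟪ a ∷ x , b ∷ y ⟫ = sign (a xor b) +ℤ ⟪ x , y ⟫

∑-cong : ∀ m {f g : Fin m → ℤ} → f ≗ g → ∑ m f ≡ ∑ m g
∑-cong zero f≗g = refl
∑-cong (suc m) f≗g = cong₂ _+ℤ_ (f≗g Fin.zero) (∑-cong m (f≗g ∘ Fin.suc))

∑-sign-* : ∀ m (f g : Fin m → Bool) →
  ∑ m (λ k → sign (f k) *ℤ sign (g k)) ≡ ⟪ tabulate f , tabulate g ⟫
∑-sign-* zero f g = refl
∑-sign-* (suc m) f g =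
  cong₂ _+ℤ_ (sign-* (f Fin.zero) (g Fin.zero)) (∑-sign-* m (f ∘ Fin.suc) (g ∘ Fin.suc))

⟪⟫-self : (x : Word m) → ⟪ x , x ⟫ ≡ + m
⟪⟫-self [] = refl
⟪⟫-self (a ∷ x) = cong₂ (λ b z → sign b +ℤ z) (Bool.xor-same a) (⟪⟫-self x)

⟪⟫-complementʳ : (x y : Word m) → ⟪ x , complement y ⟫ ≡ - ⟪ x , y ⟫
⟪⟫-complementʳ [] [] = refl
⟪⟫-complementʳ (a ∷ x) (b ∷ y) = begin
  sign (a xor not b) +ℤ ⟪ x , complement y ⟫ ≡⟨ cong₂ _+ℤ_ sign-a⊕¬b (⟪⟫-complementʳ x y) ⟩
  - sign (a xor b) +ℤ - ⟪ x , y ⟫          ≡⟨ ℤ.neg-distrib-+ (sign (a xor b)) ⟪ x , y ⟫ ⟨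
  - (sign (a xor b) +ℤ ⟪ x , y ⟫)          ∎
  where
  open ≡-Reasoning
  sign-a⊕¬b : sign (a xor not b) ≡ - sign (a xor b)
  sign-a⊕¬b = trans (cong sign (sym (Bool.not-distribʳ-xor a b))) (sign-not (a xor b))

⟪⟫-complementˡ : (x y : Word m) → ⟪ complement x , y ⟫ ≡ - ⟪ x , y ⟫
⟪⟫-complementˡ [] [] = refl
⟪⟫-complementˡ (a ∷ x) (b ∷ y) = begin
  sign (not a xor b) +ℤ ⟪ complement x , y ⟫ ≡⟨ cong₂ _+ℤ_ sign-¬a⊕b (⟪⟫-complementˡ x y) ⟩
  - sign (a xor b) +ℤ - ⟪ x , y ⟫          ≡⟨ ℤ.neg-distrib-+ (sign (a xor b)) ⟪ x , y ⟫ ⟨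
  - (sign (a xor b) +ℤ ⟪ x , y ⟫)          ∎
  where
  open ≡-Reasoning
  sign-¬a⊕b : sign (not a xor b) ≡ - sign (a xor b)
  sign-¬a⊕b = trans (cong sign (sym (Bool.not-distribˡ-xor a b))) (sign-not (a xor b))

⟪⟫-split : (s x y : Word m) →
  ⟪ x , y ⟫ ≡ ⟪ proj s x , proj s y ⟫ +ℤ ⟪ proj (complement s) x , proj (complement s) y ⟫
⟪⟫-split [] [] [] = refl
⟪⟫-split (false ∷ s) (a ∷ x) (b ∷ y) =
  trans (cong (sign (a xor b) +ℤ_) (⟪⟫-split s x y)) (x∙yz≈y∙xz (sign (a xor b)) ⟪ proj s x , proj s y ⟫ _)
⟪⟫-split (true ∷ s) (a ∷ x) (b ∷ y) =
  trans (cong (sign (a xor b) +ℤ_) (⟪⟫-split s x y)) (sym (ℤ.+-assoc (sign (a xor b)) _ _))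

⟪⟫-split-⊕ : (s x y : Word m) →
  ⟪ x , y ⊕ s ⟫ ≡ - ⟪ proj s x , proj s y ⟫ +ℤ ⟪ proj (complement s) x , proj (complement s) y ⟫
⟪⟫-split-⊕ s x y = begin
  ⟪ x , y ⊕ s ⟫
    ≡⟨ ⟪⟫-split s x (y ⊕ s) ⟩
  ⟪ proj s x , proj s (y ⊕ s) ⟫ +ℤ ⟪ proj s̄ x , proj s̄ (y ⊕ s) ⟫
    ≡⟨ cong₂ (λ u v → ⟪ proj s x , u ⟫ +ℤ ⟪ proj s̄ x , v ⟫) (proj-⊕-self s y) (proj-complement-⊕-self s y) ⟩
  ⟪ proj s x , complement (proj s y) ⟫ +ℤ ⟪ proj s̄ x , proj s̄ y ⟫
    ≡⟨ cong (_+ℤ ⟪ proj s̄ x , proj s̄ y ⟫) (⟪⟫-complementʳ (proj s x) (proj s y)) ⟩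
  - ⟪ proj s x , proj s y ⟫ +ℤ ⟪ proj s̄ x , proj s̄ y ⟫
    ∎
  where
  open ≡-Reasoning
  s̄ = complement s

⟪⟫-⊕-self : (s x : Word m) → ⟪ x , x ⊕ s ⟫ ≡ - + wt s +ℤ + wt (complement s)
⟪⟫-⊕-self s x = trans (⟪⟫-split-⊕ s x x)
  (cong₂ (λ a b → - a +ℤ b) (⟪⟫-self (proj s x)) (⟪⟫-self (proj (complement s) x)))

m+m≡n+n⇒m≡n : ∀ m n → m + m ≡ n + n → m ≡ n
m+m≡n+n⇒m≡n m n m+m≡n+n = ℕ.*-cancelˡ-≡ m n 2 (begin
  2 * m ≡⟨ cong (_+_ m) (ℕ.+-identityʳ m) ⟩
  m + m ≡⟨ m+m≡n+n ⟩
  n + n ≡⟨ cong (_+_ n) (ℕ.+-identityʳ n) ⟨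
  2 * n ∎)
  where open ≡-Reasoning

i≡-i⇒i≡0 : ∀ i → i ≡ - i → i ≡ 0ℤ
i≡-i⇒i≡0 (+ zero) _ = refl

i+j≡0∧-i+j≡0⇒i≡0 : ∀ i j → i +ℤ j ≡ 0ℤ → - i +ℤ j ≡ 0ℤ → i ≡ 0ℤ
i+j≡0∧-i+j≡0⇒i≡0 i j i+j≡0 -i+j≡0 = i≡-i⇒i≡0 i (∙-cancelʳ j i (- i) (trans i+j≡0 (sym -i+j≡0)))

-i+j≡0⇒i≡j : ∀ i j → - i +ℤ j ≡ 0ℤ → i ≡ j
-i+j≡0⇒i≡j i j -i+j≡0 = sym (ℤ.i-j≡0⇒i≡j j i (trans (ℤ.+-comm j (- i)) -i+j≡0))

orient : Bool → Word m → Word m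
orient false x = x
orient true x = complement x

orient-orient : ∀ a b (x : Word m) → orient a (orient b x) ≡ orient (a xor b) x
orient-orient false b x = refl
orient-orient true false x = refl
orient-orient true true x = complement-involutive x

lookup-orient : ∀ b (x : Word m) k → lookup (orient b x) k ≡ b xor lookup x k
lookup-orient false x k = refl
lookup-orient true x k = Vec.lookup-map k not x

proj-orient : ∀ b (s x : Word m) → proj s (orient b x) ≡ orient b (proj s x)
proj-orient false s x = refl
proj-orient true s x = proj-complement s x

orient-⊥ : ∀ a b (x y : Word m) → ⟪ x , y ⟫ ≡ 0ℤ → ⟪ orient a x , orient b y ⟫ ≡ 0ℤ
orient-⊥ false false x y x⊥y = x⊥y
orient-⊥ false true x y x⊥y = trans (⟪⟫-complementʳ x y) (cong -_ x⊥y)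
orient-⊥ true false x y x⊥y = trans (⟪⟫-complementˡ x y) (cong -_ x⊥y)
orient-⊥ true true x y x⊥y = trans (⟪⟫-complementˡ x (complement y)) (cong -_ (orient-⊥ false true x y x⊥y))

Generated : ∀ {k} → (Fin k → Word m) → Code m
Generated w v = ∃₂ λ i b → v ≡ orient b (w i)

generated⇔ : ∀ {k} (w : Fin k → Word m) v →
  Generated w v ⇔ (∃ λ i → (v ≡ w i) ⊎ (v ≡ complement (w i)))
generated⇔ w v = mk⇔ to′ from′
  where
  to′ : Generated w v → ∃ λ i → (v ≡ w i) ⊎ (v ≡ complement (w i))
  to′ (i , false , v≡wᵢ) = i , inj₁ v≡wᵢ
  to′ (i , true , v≡w̄ᵢ) = i , inj₂ v≡w̄ᵢ
  from′ : (∃ λ i → (v ≡ w i) ⊎ (v ≡ complement (w i))) → Generated w v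
  from′ (i , inj₁ v≡wᵢ) = i , false , v≡wᵢ
  from′ (i , inj₂ v≡w̄ᵢ) = i , true , v≡w̄ᵢ

generated-orient : ∀ {k} {w : Fin k → Word m} {v} b → Generated w v → Generated w (orient b v)
generated-orient {w = w} b (i , c , refl) = i , b xor c , orient-orient b c (w i)

generated-≗ : ∀ {k} {w w′ : Fin k → Word m} → w ≗ w′ → ∀ {v} → Generated w v → Generated w′ v
generated-≗ w≗w′ (i , b , refl) = i , b , cong (orient b) (w≗w′ i)

generated-reorient : ∀ {k} (c : Fin k → Bool) (w : Fin k → Word m) v →
  Generated w v ⇔ Generated (λ i → orient (c i) (w i)) v
generated-reorient c w v = mk⇔ to′ from′
  where
  to′ : Generated w v → Generated (λ i → orient (c i) (w i)) v
  to′ (i , b , refl) = i , b xor c i , (begin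
    orient b (w i)                       ≡⟨ cong (λ a → orient a (w i)) (xor-cancelʳ b (c i)) ⟨
    orient ((b xor c i) xor c i) (w i)   ≡⟨ orient-orient (b xor c i) (c i) (w i) ⟨
    orient (b xor c i) (orient (c i) (w i)) ∎)
    where open ≡-Reasoning
  from′ : Generated (λ i → orient (c i) (w i)) v → Generated w v
  from′ (i , b , refl) = i , b xor c i , orient-orient b (c i) (w i)

PairwiseOrthogonal : ∀ {k} → (Fin k → Word m) → Set
PairwiseOrthogonal w = ∀ {i j} → i ≢ j → ⟪ w i , w j ⟫ ≡ 0ℤ

δN-≢ : {i j : Fin N} → i ≢ j → δN i j ≡ 0ℤ
δN-≢ {i = i} {j} i≢j with i ≟ j
... | yes i≡j = ⊥-elim (i≢j i≡j)
... | no _ = refl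

binRow-orthogonal : ∀ {H} → IsHadamardMatrix N H → PairwiseOrthogonal (binRow H)
binRow-orthogonal {N} {H} isH {i} {j} i≢j = begin
  ⟪ binRow H i , binRow H j ⟫
    ≡⟨ ∑-sign-* N (toBit ∘ H i) (toBit ∘ H j) ⟨
  ∑ N (λ k → sign (toBit (H i k)) *ℤ sign (toBit (H j k)))
    ≡⟨ ∑-cong N (λ k → cong₂ _*ℤ_ (sign-toBit _ (entries i k)) (sign-toBit _ (entries j k))) ⟩
  ∑ N (λ k → H i k *ℤ H j k)
    ≡⟨ orthogonal i j ⟩
  δN i j
    ≡⟨ δN-≢ i≢j ⟩
  0ℤ ∎
  where
  open ≡-Reasoning
  open IsHadamardMatrix isH

signMatrix : (Fin N → Word N) → Fin N → Fin N → ℤ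
signMatrix w i k = sign (lookup (w i) k)

binRow-signMatrix : (w : Fin N → Word N) → binRow (signMatrix w) ≗ w
binRow-signMatrix w i = trans (Vec.tabulate-cong (λ k → toBit-sign (lookup (w i) k))) (Vec.tabulate∘lookup (w i))

signMatrix-isHadamard : {w : Fin N → Word N} → PairwiseOrthogonal w → IsHadamardMatrix N (signMatrix w)
signMatrix-isHadamard {N} {w} w⊥ = record { entries = λ i k → sign-±1 (lookup (w i) k) ; orthogonal = orthogonal }
  where
  sign-±1 : ∀ a → (sign a ≡ + 1) ⊎ (sign a ≡ - (+ 1))
  sign-±1 false = inj₁ refl
  sign-±1 true = inj₂ refl
  ∑≡⟪⟫ : ∀ i j → ∑ N (λ k → signMatrix w i k *ℤ signMatrix w j k) ≡ ⟪ w i , w j ⟫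
  ∑≡⟪⟫ i j = trans (∑-sign-* N (lookup (w i)) (lookup (w j)))
                   (cong₂ ⟪_,_⟫ (Vec.tabulate∘lookup (w i)) (Vec.tabulate∘lookup (w j)))
  orthogonal : ∀ i j → ∑ N (λ k → signMatrix w i k *ℤ signMatrix w j k) ≡ δN i j
  orthogonal i j with i ≟ j
  ... | yes refl = trans (∑≡⟪⟫ i i) (⟪⟫-self (w i))
  ... | no i≢j = trans (∑≡⟪⟫ i j) (w⊥ i≢j)

hadamardCode⇒rows : {C : Code N} → IsBinaryHadamardCode N C →
  ∃ λ w → PairwiseOrthogonal w × (∀ v → C v ⇔ Generated w v)
hadamardCode⇒rows (H , isH , C⇔) =
  binRow H , binRow-orthogonal isH , λ v → ⇔.trans (C⇔ v) (⇔.sym (generated⇔ (binRow H) v))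

rows⇒hadamardCode : {C : Code N} {w : Fin N → Word N} → PairwiseOrthogonal w →
  (∀ v → C v ⇔ Generated w v) → IsBinaryHadamardCode N C
rows⇒hadamardCode {w = w} w⊥ C⇔ = signMatrix w , signMatrix-isHadamard {w = w} w⊥ , λ v →
  ⇔.trans (C⇔ v) (⇔.trans (mk⇔ (generated-≗ (sym ∘ binRow-signMatrix w)) (generated-≗ (binRow-signMatrix w)))
                          (generated⇔ (binRow (signMatrix w)) v))

record Enumeration {M} (P : Fin M → Set) (k : ℕ) : Set where
  field
    index : Fin k → Fin M
    index-injective : Injective _≡_ _≡_ index
    index-∈ : ∀ a → P (index a)
    index-onto : ∀ {i} → P i → ∃ λ a → index a ≡ i

Unique-lookup-injective : ∀ {A : Set} {xs : List A} → Unique xs → Injective _≡_ _≡_ (List.lookup xs)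
Unique-lookup-injective (_ ∷ _) {Fin.zero} {Fin.zero} _ = refl
Unique-lookup-injective (x∉xs ∷ _) {Fin.zero} {Fin.suc j} x≡xsⱼ = ⊥-elim (All.lookup x∉xs (∈-lookup j) x≡xsⱼ)
Unique-lookup-injective (x∉xs ∷ _) {Fin.suc i} {Fin.zero} xsᵢ≡x = ⊥-elim (All.lookup x∉xs (∈-lookup i) (sym xsᵢ≡x))
Unique-lookup-injective (_ ∷ xs!) {Fin.suc i} {Fin.suc j} xsᵢ≡xsⱼ = cong Fin.suc (Unique-lookup-injective xs! xsᵢ≡xsⱼ)

length-filter+length-filter-∁ : ∀ {A : Set} {P : A → Set} (P? : Decidable P) xs →
  length (filter P? xs) + length (filter (∁? P?) xs) ≡ length xs
length-filter+length-filter-∁ P? List.[] = refl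
length-filter+length-filter-∁ P? (x List.∷ xs) with P? x
... | yes _ = cong suc (length-filter+length-filter-∁ P? xs)
... | no _ = trans (ℕ.+-suc _ _) (cong suc (length-filter+length-filter-∁ P? xs))

count : ∀ {M} {P : Fin M → Set} → Decidable P → ℕ
count {M} P? = length (filter P? (allFin M))

enumeration : ∀ {M} {P : Fin M → Set} (P? : Decidable P) → Enumeration P (count P?)
enumeration {M} P? = record
  { index = List.lookup Ps
  ; index-injective = Unique-lookup-injective (Unique.filter⁺ P? (Unique.allFin⁺ M))
  ; index-∈ = λ a → proj₂ (∈-filter⁻ P? {xs = allFin M} (∈-lookup {xs = Ps} a))
  ; index-onto = λ {i} Pi → let i∈Ps = ∈-filter⁺ P? (∈-allFin i) Pi in Any.index i∈Ps , sym (Any.lookup-index i∈Ps)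
  }
  where
  Ps : List (Fin M)
  Ps = filter P? (allFin M)

count+count-∁ : ∀ {M} {P : Fin M → Set} (P? : Decidable P) → count P? + count (∁? P?) ≡ M
count+count-∁ {M} P? = trans (length-filter+length-filter-∁ P? (allFin M)) (List.length-tabulate (λ i → i))

enumeration-≤ : ∀ {M} {P Q : Fin M → Set} {k l} → Enumeration P k → Enumeration Q l →
  {f : Fin M → Fin M} → Injective _≡_ _≡_ f → (∀ {i} → P i → Q (f i)) → k ≤ l
enumeration-≤ EP EQ {f} f-injective f[P]⊆Q = injective⇒≤ g-injective
  where
  module EP = Enumeration EP
  module EQ = Enumeration EQ
  g : Fin _ → Fin _
  g a = proj₁ (EQ.index-onto (f[P]⊆Q (EP.index-∈ a)))
  index∘g : ∀ a → EQ.index (g a) ≡ f (EP.index a)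
  index∘g a = proj₂ (EQ.index-onto (f[P]⊆Q (EP.index-∈ a)))
  g-injective : Injective _≡_ _≡_ g
  g-injective {a} {b} gₐ≡g_b =
    EP.index-injective (f-injective (trans (sym (index∘g a)) (trans (cong EQ.index gₐ≡g_b) (index∘g b))))

module KernelProjection
  {N} (C : Code N) (row : Fin N → Word N) (row⊥ : PairwiseOrthogonal row)
  (C⇔row : ∀ v → C v ⇔ Generated row v) (s : Word N) (s∈K : InKernel C s)
  {t j : Fin N} (s[t]≡0 : lookup s t ≡ false) (s[j]≡1 : lookup s j ≡ true)
  where

  w : Fin N → Word N
  w i = orient (lookup (row i) t) (row i)

  w[t]≡0 : ∀ i → lookup (w i) t ≡ false
  w[t]≡0 i = trans (lookup-orient (lookup (row i) t) (row i) t) (Bool.xor-same (lookup (row i) t))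

  w⊥ : PairwiseOrthogonal w
  w⊥ {i} {k} i≢k = orient-⊥ (lookup (row i) t) (lookup (row k) t) (row i) (row k) (row⊥ i≢k)

  C⇔w : ∀ v → C v ⇔ Generated w v
  C⇔w v = ⇔.trans (C⇔row v) (generated-reorient (λ i → lookup (row i) t) row v)

  w-injective : Injective _≡_ _≡_ w
  w-injective {i} {k} wᵢ≡wₖ with i ≟ k
  ... | yes i≡k = i≡k
  ... | no i≢k = ⊥-elim (+N≢0 t (trans (sym (⟪⟫-self (w i))) (trans (cong (λ x → ⟪ w i , x ⟫) wᵢ≡wₖ) (w⊥ i≢k))))
    where
    +N≢0 : ∀ {N} → Fin N → + N ≢ 0ℤ
    +N≢0 Fin.zero ()
    +N≢0 (Fin.suc _) ()

  w-unique : ∀ {v} → C v → lookup v t ≡ false → ∃ λ k → v ≡ w k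
  w-unique Cv v[t]≡0 with to (C⇔w _) Cv
  ... | k , false , v≡wₖ = k , v≡wₖ
  ... | k , true , refl =
    ⊥-elim (Bool.not-¬ (sym (w[t]≡0 k)) (sym (trans (sym (lookup-orient true (w k) t)) v[t]≡0)))

  σ-spec : ∀ i → ∃ λ k → w i ⊕ s ≡ w k
  σ-spec i = w-unique (to (s∈K (w i)) (from (C⇔w (w i)) (i , false , refl)))
                      (trans (lookup-⊕ (w i) s t) (cong₂ _xor_ (w[t]≡0 i) s[t]≡0))

  σ : Fin N → Fin N
  σ i = proj₁ (σ-spec i)

  w-σ : ∀ i → w i ⊕ s ≡ w (σ i)
  w-σ i = proj₂ (σ-spec i)

  σ-injective : Injective _≡_ _≡_ σ
  σ-injective {i} {k} σi≡σk = w-injective (begin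
    w i           ≡⟨ ⊕-cancelʳ (w i) s ⟨
    (w i ⊕ s) ⊕ s ≡⟨ cong (_⊕ s) (w-σ i) ⟩
    w (σ i) ⊕ s   ≡⟨ cong (λ l → w l ⊕ s) σi≡σk ⟩
    w (σ k) ⊕ s   ≡⟨ cong (_⊕ s) (w-σ k) ⟨
    (w k ⊕ s) ⊕ s ≡⟨ ⊕-cancelʳ (w k) s ⟩
    w k           ∎)
    where open ≡-Reasoning

  colour : Fin N → Bool
  colour i = lookup (w i) j

  colour-σ : ∀ i → colour (σ i) ≡ not (colour i)
  colour-σ i = begin
    lookup (w (σ i)) j           ≡⟨ cong (λ x → lookup x j) (w-σ i) ⟨
    lookup (w i ⊕ s) j           ≡⟨ lookup-⊕ (w i) s j ⟩
    colour i xor lookup s j      ≡⟨ cong (colour i xor_) s[j]≡1 ⟩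
    colour i xor true            ≡⟨ Bool.xor-comm (colour i) true ⟩
    not (colour i)               ∎
    where open ≡-Reasoning

  σ-≢ : ∀ i → i ≢ σ i
  σ-≢ i i≡σi = Bool.not-¬ refl (trans (cong colour i≡σi) (colour-σ i))

  White : Fin N → Set
  White i = colour i ≡ false

  White? : Decidable White
  White? i = colour i Bool.≟ false

  White⇒¬White∘σ : ∀ {i} → White i → ¬ White (σ i)
  White⇒¬White∘σ {i} white = Bool.not-¬ (sym white) ∘ sym ∘ trans (sym (colour-σ i))

  ¬White⇒White∘σ : ∀ {i} → ¬ White i → White (σ i)
  ¬White⇒White∘σ {i} ¬white with colour i | colour-σ i
  ... | false | _ = ⊥-elim (¬white refl)
  ... | true | colourσi≡false = colourσi≡false

  -- The row index t is arbitrary: any row w_i with its partner w_σ(i) will do.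
  wt-balanced : wt s ≡ wt (complement s)
  wt-balanced = ℤ.+-injective (-i+j≡0⇒i≡j (+ wt s) (+ wt (complement s)) (begin
    - + wt s +ℤ + wt (complement s) ≡⟨ ⟪⟫-⊕-self s (w t) ⟨
    ⟪ w t , w t ⊕ s ⟫              ≡⟨ cong (λ x → ⟪ w t , x ⟫) (w-σ t) ⟩
    ⟪ w t , w (σ t) ⟫              ≡⟨ w⊥ (σ-≢ t) ⟩
    0ℤ                             ∎))
    where open ≡-Reasoning

  wt+wt≡N : wt s + wt s ≡ N
  wt+wt≡N = trans (cong (_+_ (wt s)) wt-balanced) (wt+wt-complement s)

  count-White : count White? ≡ wt s
  count-White = m+m≡n+n⇒m≡n (count White?) (wt s) (begin
    count White? + count White?       ≡⟨ cong (_+_ (count White?)) (ℕ.≤-antisym White≤Black Black≤White) ⟩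
    count White? + count (∁? White?)  ≡⟨ count+count-∁ White? ⟩
    N                                 ≡⟨ wt+wt≡N ⟨
    wt s + wt s                       ∎)
    where
    open ≡-Reasoning
    White≤Black : count White? ≤ count (∁? White?)
    White≤Black = enumeration-≤ (enumeration White?) (enumeration (∁? White?)) σ-injective White⇒¬White∘σ
    Black≤White : count (∁? White?) ≤ count White?
    Black≤White = enumeration-≤ (enumeration (∁? White?)) (enumeration White?) σ-injective ¬White⇒White∘σ

  open Enumeration (subst (Enumeration White) count-White (enumeration White?))

  p : Fin (wt s) → Word (wt s)
  p a = proj s (w (index a))

  proj-⊥ : ∀ {i k} → i ≢ k → i ≢ σ k → ⟪ proj s (w i) , proj s (w k) ⟫ ≡ 0ℤ
  proj-⊥ {i} {k} i≢k i≢σk = i+j≡0∧-i+j≡0⇒i≡0 _ _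
    (trans (sym (⟪⟫-split s (w i) (w k))) (w⊥ i≢k))
    (trans (sym (⟪⟫-split-⊕ s (w i) (w k))) (trans (cong (λ x → ⟪ w i , x ⟫) (w-σ k)) (w⊥ i≢σk)))

  p⊥ : PairwiseOrthogonal p
  p⊥ {a} {b} a≢b = proj-⊥ (a≢b ∘ index-injective)
    (λ iₐ≡σi_b → White⇒¬White∘σ (index-∈ b) (subst White iₐ≡σi_b (index-∈ a)))

  proj-w-generated : ∀ k → Generated p (proj s (w k))
  proj-w-generated k = by-colour (White? k)
    where
    by-colour : Dec (White k) → Generated p (proj s (w k))
    by-colour (yes white) = let (a , iₐ≡k) = index-onto white in a , false , cong (proj s ∘ w) (sym iₐ≡k)
    by-colour (no black) = let (a , iₐ≡σk) = index-onto (¬White⇒White∘σ black) in a , true , (begin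
      proj s (w k)                   ≡⟨ cong (proj s) (⊕-cancelʳ (w k) s) ⟨
      proj s ((w k ⊕ s) ⊕ s)         ≡⟨ proj-⊕-self s (w k ⊕ s) ⟩
      complement (proj s (w k ⊕ s))  ≡⟨ cong (complement ∘ proj s) (w-σ k) ⟩
      complement (proj s (w (σ k)))  ≡⟨ cong (complement ∘ proj s ∘ w) (sym iₐ≡σk) ⟩
      complement (p a)               ∎)
      where open ≡-Reasoning

  proj-generated : ∀ {u} → Generated w u → Generated p (proj s u)
  proj-generated (k , b , u≡wₖᵇ) = subst (Generated p)
    (sym (trans (cong (proj s) u≡wₖᵇ) (proj-orient b s (w k))))
    (generated-orient b (proj-w-generated k))

  projCode⇔p : ∀ v → projCode C s v ⇔ Generated p v
  projCode⇔p v = mk⇔ to′ from′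
    where
    to′ : projCode C s v → Generated p v
    to′ (u , Cu , proj-s-u≡v) = subst (Generated p) proj-s-u≡v (proj-generated (to (C⇔w u) Cu))
    from′ : Generated p v → projCode C s v
    from′ (a , b , v≡pₐᵇ) = orient b (w (index a)) , from (C⇔w _) (index a , b , refl) ,
                           trans (proj-orient b s (w (index a))) (sym v≡pₐᵇ)

  projCode-isHadamard : IsBinaryHadamardCode (wt s) (projCode C s)
  projCode-isHadamard = rows⇒hadamardCode p⊥ projCode⇔p

proposition6 : (n : ℕ) (C : Code (4 * n)) → IsBinaryHadamardCode (4 * n) C →
    (s : Word (4 * n)) → InKernel C s → ¬ (s ≡ 𝟎) → ¬ (s ≡ 𝟏) →
    (wt s ≡ 2 * n) × IsBinaryHadamardCode (wt s) (projCode C s)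
proposition6 n C C-isHadamard s s∈K s≢𝟎 s≢𝟏
  with hadamardCode⇒rows C-isHadamard | ≢𝟏⇒∃false s s≢𝟏 | ≢𝟎⇒∃true s s≢𝟎
... | row , row⊥ , C⇔row | t , s[t]≡0 | j , s[j]≡1 =
  m+m≡n+n⇒m≡n (wt s) (2 * n) (trans wt+wt≡N (ℕ.*-distribʳ-+ n 2 2)) , projCode-isHadamard
  where open KernelProjection C row row⊥ C⇔row s s∈K s[t]≡0 s[j]≡1
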